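{- Let $\mathcal{C}(\widetilde{D}_6)$ be the point-line incidence structure with points $0,\dots,6$ and lines $\{0,2\},\{1,2\},\{2,3\},\{3,4\},\{4,5\},\{4,6\}$. Consider the two labelings of its points by elements of $\overline{\mathcal{P}}_2$: (a) $0\mapsto ZI,\ 1\mapsto XI,\ 2\mapsto YI,\ 3\mapsto II,\ 4\mapsto IY,\ 5\mapsto IZ,\ 6\mapsto IX$; (b) $0\mapsto ZI,\ 1\mapsto XI,\ 2\mapsto II,\ 3\mapsto YY,\ 4\mapsto II,\ 5\mapsto IZ,\ 6\mapsto IX$; and in each case label a geometric hyperplane by the product of the labels of its points. Then (a) and (b) induce the same labeling of the $15$ hyperplanes containing $\{2,3,4\}$, which is a bijection onto the $15$ non-identity elements of $\overline{\mathcal{P}}_2$ such that the labels on each three-point Veldkamp line multiply to $II$ and the pairwise commuting such triples form a $W(3,2)$; the two lines shared with the Fano planes formed by the hyperplanes containing $\{0,1,3,4\}$, respectively $\{2,3,5,6\}$, carry the labels $\{IX,IY,IZ\}$ and $\{XI,YI,ZI\}$, and the remaining nine labels form a Mermin–Peres magic square ($3\times 3$ grid of pairwise commuting triples). Under labeling (b), all three hyperplanes of the three-point Veldkamp line $\{\{0,1,3,5,6\},\{0,1,3,4,5,6\},\{0,1,2,3,5,6\}\}$ are labeled $II$.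
   Context: A geometric hyperplane is a proper subset $H$ of the point set such that every line is either contained in $H$ or meets $H$ in exactly one point. A three-point Veldkamp line is a set $\{H_1,H_2,H_3\}$ of three distinct geometric hyperplanes with $H_3$ the complement of $H_1\triangle H_2$. $\overline{\mathcal{P}}_N$ is the $N$-qubit Pauli group modulo its center $\{\pm I^{\otimes N},\pm iI^{\otimes N}\}$, elements written as words $A_1\cdots A_N$ ($A_k\in\{I,X,Y,Z\}$) and multiplied ignoring phases; commutation is that of representing matrices. $W(3,2)$ is the symplectic polar space of rank $2$ over $\mathrm{GF}(2)$. A $3\times3$ grid has $9$ points and $6$ lines of size three in two parallel classes of three, each point on one line of each class. -}

module Defs where

open import Data.Bool using (Bool; true; false; _∧_; _∨_; not; _xor_; if_then_else_)
open import Data.Nat using (ℕ; zero; suc)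
open import Data.Fin using (Fin; zero; suc)
open import Data.List using (List; []; _∷_; length; filter; foldr)
open import Data.List.Relation.Unary.All using (All)
open import Data.Vec using (Vec; []; _∷_; zipWith)
open import Data.Product using (_×_; _,_; ∃; ∃-syntax; Σ-syntax)
open import Data.Sum using (_⊎_)
open import Function using (_⇔_)
open import Relation.Nullary using (¬_)
open import Relation.Binary.PropositionalEquality using (_≡_; _≢_)
open import Data.Fin.Subset as S using (Subset; _∈_; _⊆_; ∁)
open import Data.Fin.Subset.Properties using (_∈?_)
open import Data.Unit using (⊤)

-- Point-line incidence structures on the point set Fin n.
-- A line is a list of (distinct) points.

_△_ : ∀ {n} → Subset n → Subset n → Subset n
_△_ = zipWith _xor_

IsGeomHyperplane : ∀ {n} → List (List (Fin n)) → Subset n → Set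
IsGeomHyperplane {n} lines H =
  H ≢ S.⊤ × All (λ l → All (_∈ H) l ⊎ length (filter (_∈? H) l) ≡ 1) lines

IsVeldkampLine : ∀ {n} → List (List (Fin n)) → Subset n → Subset n → Subset n → Set
IsVeldkampLine lines H₁ H₂ H₃ =
  IsGeomHyperplane lines H₁ × IsGeomHyperplane lines H₂ × IsGeomHyperplane lines H₃ ×
  H₁ ≢ H₂ × H₁ ≢ H₃ × H₂ ≢ H₃ × H₃ ≡ ∁ (H₁ △ H₂)

Pt : Set
Pt = Fin 7

p0 p1 p2 p3 p4 p5 p6 : Pt
p0 = zero
p1 = suc zero
p2 = suc (suc zero)
p3 = suc (suc (suc zero))
p4 = suc (suc (suc (suc zero)))
p5 = suc (suc (suc (suc (suc zero))))
p6 = suc (suc (suc (suc (suc (suc zero)))))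

linesD6 : List (List Pt)
linesD6 = (p0 ∷ p2 ∷ []) ∷ (p1 ∷ p2 ∷ []) ∷ (p2 ∷ p3 ∷ []) ∷
          (p3 ∷ p4 ∷ []) ∷ (p4 ∷ p5 ∷ []) ∷ (p4 ∷ p6 ∷ []) ∷ []

IsHyp : Subset 7 → Set
IsHyp = IsGeomHyperplane linesD6

IsVLine : Subset 7 → Subset 7 → Subset 7 → Set
IsVLine = IsVeldkampLine linesD6

setOf : List Pt → Subset 7
setOf = foldr (λ i s → S.⁅ i ⁆ S.∪ s) S.⊥

data Pauli : Set where
  I X Y Z : Pauli

-- product of single-qubit Paulis, ignoring phases
_·₁_ : Pauli → Pauli → Pauli
I ·₁ b = b
a ·₁ I = a
X ·₁ X = I
X ·₁ Y = Z
X ·₁ Z = Y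
Y ·₁ X = Z
Y ·₁ Y = I
Y ·₁ Z = X
Z ·₁ X = Y
Z ·₁ Y = X
Z ·₁ Z = I

anti₁ : Pauli → Pauli → Bool
anti₁ I _ = false
anti₁ _ I = false
anti₁ X X = false
anti₁ Y Y = false
anti₁ Z Z = false
anti₁ _ _ = true

record P2 : Set where
  constructor _⊗_
  field
    fst : Pauli
    snd : Pauli

infixl 7 _·_
_·_ : P2 → P2 → P2
(a ⊗ b) · (c ⊗ d) = (a ·₁ c) ⊗ (b ·₁ d)

-- A₁A₂ and B₁B₂ commute (as matrices) iff an even number of the
-- factors anticommute.
Commute : P2 → P2 → Set
Commute (a ⊗ b) (c ⊗ d) = anti₁ a c xor anti₁ b d ≡ false

II IX IY IZ XI YI ZI : P2
II = I ⊗ I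
IX = I ⊗ X
IY = I ⊗ Y
IZ = I ⊗ Z
XI = X ⊗ I
YI = Y ⊗ I
ZI = Z ⊗ I

labelProd : ∀ {n} → (Fin n → P2) → Subset n → P2
labelProd {zero} f [] = II
labelProd {suc n} f (b ∷ H) =
  (if b then f zero else II) · labelProd (λ i → f (suc i)) H

labA : Pt → P2
labA zero = Z ⊗ I
labA (suc zero) = X ⊗ I
labA (suc (suc zero)) = Y ⊗ I
labA (suc (suc (suc zero))) = I ⊗ I
labA (suc (suc (suc (suc zero)))) = I ⊗ Y
labA (suc (suc (suc (suc (suc zero))))) = I ⊗ Z
labA (suc (suc (suc (suc (suc (suc zero)))))) = I ⊗ X

labB : Pt → P2
labB zero = Z ⊗ I
labB (suc zero) = X ⊗ I
labB (suc (suc zero)) = I ⊗ I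
labB (suc (suc (suc zero))) = Y ⊗ Y
labB (suc (suc (suc (suc zero)))) = I ⊗ I
labB (suc (suc (suc (suc (suc zero))))) = I ⊗ Z
labB (suc (suc (suc (suc (suc (suc zero)))))) = I ⊗ X

hypLabelA hypLabelB : Subset 7 → P2
hypLabelA = labelProd labA
hypLabelB = labelProd labB

-- W(3,2): points = nonzero vectors of GF(2)^4, lines = totally isotropic
-- 2-dimensional subspaces {u, v, u+v} w.r.t. the symplectic form
-- ω(x,y) = x₁y₂ + x₂y₁ + x₃y₄ + x₄y₃.
V4 : Set
V4 = Vec Bool 4

zero4 : V4
zero4 = false ∷ false ∷ false ∷ false ∷ []

ω : V4 → V4 → Bool
ω (x₁ ∷ x₂ ∷ x₃ ∷ x₄ ∷ []) (y₁ ∷ y₂ ∷ y₃ ∷ y₄ ∷ []) =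
  ((x₁ ∧ y₂) xor (x₂ ∧ y₁)) xor ((x₃ ∧ y₄) xor (x₄ ∧ y₃))

W32Point : V4 → Set
W32Point u = u ≢ zero4

W32Line : V4 → V4 → V4 → Set
W32Line u v w = u ≢ zero4 × v ≢ zero4 × w ≢ zero4 × u ≢ v × u ≢ w × v ≢ w ×
                zipWith _xor_ u v ≡ w × ω u v ≡ false

V3 : Set
V3 = Vec Bool 3

zero3 : V3
zero3 = false ∷ false ∷ false ∷ []

FanoLine : V3 → V3 → V3 → Set
FanoLine u v w = u ≢ zero3 × v ≢ zero3 × w ≢ zero3 × u ≢ v × u ≢ w × v ≢ w ×
                 zipWith _xor_ u v ≡ w

record Isomorphic {V : Set} (P : Subset 7 → Set) (Ln : Subset 7 → Subset 7 → Subset 7 → Set)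
                  (Q : V → Set) (M : V → V → V → Set) : Set where
  field
    φ        : Subset 7 → V
    maps     : ∀ H → P H → Q (φ H)
    injective : ∀ H H' → P H → P H' → φ H ≡ φ H' → H ≡ H'
    surjective : ∀ v → Q v → ∃[ H ] (P H × φ H ≡ v)
    lines⇔   : ∀ H₁ H₂ H₃ → P H₁ → P H₂ → P H₃ → (Ln H₁ H₂ H₃ ⇔ M (φ H₁) (φ H₂) (φ H₃))

GridLine : (Fin 3 × Fin 3) → (Fin 3 × Fin 3) → (Fin 3 × Fin 3) → Set
GridLine (i₁ , j₁) (i₂ , j₂) (i₃ , j₃) =
  (i₁ , j₁) ≢ (i₂ , j₂) × (i₁ , j₁) ≢ (i₃ , j₃) × (i₂ , j₂) ≢ (i₃ , j₃) ×
  ((i₁ ≡ i₂ × i₂ ≡ i₃) ⊎ (j₁ ≡ j₂ × j₂ ≡ j₃))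

GridPoint : (Fin 3 × Fin 3) → Set
GridPoint _ = ⊤

Hyp234 : Subset 7 → Set
Hyp234 H = IsHyp H × setOf (p2 ∷ p3 ∷ p4 ∷ []) ⊆ H

CommLine : Subset 7 → Subset 7 → Subset 7 → Set
CommLine H₁ H₂ H₃ = IsVLine H₁ H₂ H₃ ×
  Commute (hypLabelA H₁) (hypLabelA H₂) × Commute (hypLabelA H₁) (hypLabelA H₃) ×
  Commute (hypLabelA H₂) (hypLabelA H₃)

Hyp0134 Hyp2356 : Subset 7 → Set
Hyp0134 H = IsHyp H × setOf (p0 ∷ p1 ∷ p3 ∷ p4 ∷ []) ⊆ H
Hyp2356 H = IsHyp H × setOf (p2 ∷ p3 ∷ p5 ∷ p6 ∷ []) ⊆ H

NineLabel : P2 → Set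
NineLabel p = p ≢ II × p ≢ IX × p ≢ IY × p ≢ IZ × p ≢ XI × p ≢ YI × p ≢ ZI

Hyp9 : Subset 7 → Set
Hyp9 H = Hyp234 H × NineLabel (hypLabelA H)

-- A hyperplane of C(D̃₆) through {2,3,4} is {2,3,4} together with any proper subset of
-- {0,1,5,6}, so its complement runs over the nonzero vectors of GF(2)⁴, and H₁ H₂ H₃ form a
-- Veldkamp line exactly when their complements sum to zero.  The labels of all seven points
-- multiply to II, so the label of H is also the product of the labels of ∁ H: in symplectic
-- coordinates the labelling is a linear bijection GF(2)⁴ → GF(2)⁴, commutation becomes the
-- form ω, and the commuting Veldkamp lines are the lines of W(3,2).  Each claim is a finite
-- check, decided by enumerating a parametrisation of the relevant family of hyperplanes.
module Submission where

open import Defs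
open import Data.Bool using (Bool; true; false; T; _∧_)
import Data.Bool as Bool
open import Data.Bool.Properties using (T-∧)
open import Data.Fin using (Fin; zero; suc)
import Data.Fin as Fin
open import Data.Fin.Properties using () renaming (all? to ∀-Fin)
open import Data.Fin.Subset using (Subset; ⊤; _⊆_; ∁)
open import Data.Fin.Subset.Properties using (_∈?_; _⊆?_)
open import Data.List using (List; []; _∷_; length; filter)
open import Data.List.Relation.Unary.All using (all?)
import Data.Nat as ℕ
open import Data.Product using (_×_; _,_; ∃; ∃-syntax; proj₁; proj₂)
import Data.Product.Properties as ×
open import Data.Sum using (_⊎_; inj₁; inj₂; [_,_])
open import Data.Unit using (tt)
open import Data.Vec using (Vec; []; _∷_; zipWith; lookup; map)
import Data.Vec.Properties as Vec
open import Function using (_⇔_; mk⇔; Equivalence; _∘_)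
open import Relation.Binary.Definitions using (DecidableEquality)
open import Relation.Binary.PropositionalEquality using (_≡_; _≢_; refl)
open import Relation.Nullary using (Dec; yes; no; ¬?)
open import Relation.Nullary.Decidable
  using (True; isYes; T?; toWitness; fromWitness; from-yes; map′; _×-dec_; _⊎-dec_; _→-dec_)
open import Relation.Unary using (Decidable)

Exhaustible : Set → Set₁
Exhaustible A = ∀ {P : A → Set} → Decidable P → Dec (∀ a → P a)

Searchable : Set → Set₁
Searchable A = ∀ {P : A → Set} → Decidable P → Dec (∃ P)

-- These decisions are evaluated by the type checker; looping through a Boolean function
-- keeps nested quantifiers far cheaper than nesting Dec combinators.
allᵇ : ∀ n → (Vec Bool n → Bool) → Bool
allᵇ ℕ.zero f = f []
allᵇ (ℕ.suc n) f = allᵇ n (f ∘ (true ∷_)) ∧ allᵇ n (f ∘ (false ∷_))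

allᵇ-sound : ∀ n f → T (allᵇ n f) → ∀ v → T (f v)
allᵇ-sound ℕ.zero f holds [] = holds
allᵇ-sound (ℕ.suc n) f holds (true ∷ v) = allᵇ-sound n _ (proj₁ (Equivalence.to T-∧ holds)) v
allᵇ-sound (ℕ.suc n) f holds (false ∷ v) = allᵇ-sound n _ (proj₂ (Equivalence.to T-∧ holds)) v

allᵇ-complete : ∀ n f → (∀ v → T (f v)) → T (allᵇ n f)
allᵇ-complete ℕ.zero f holds = holds []
allᵇ-complete (ℕ.suc n) f holds =
  Equivalence.from T-∧ (allᵇ-complete n _ (holds ∘ (true ∷_)) , allᵇ-complete n _ (holds ∘ (false ∷_)))

∀-Vec? : ∀ n → Exhaustible (Vec Bool n)
∀-Vec? n P? = map′ (λ holds v → toWitness (allᵇ-sound n _ holds v))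
  (λ holds → allᵇ-complete n _ λ v → fromWitness (holds v)) (T? (allᵇ n (isYes ∘ P?)))

∃-Vec? : ∀ n → Searchable (Vec Bool n)
∃-Vec? ℕ.zero P? = map′ ([] ,_) (λ { ([] , P[]) → P[] }) (P? [])
∃-Vec? (ℕ.suc n) P? = map′ [ (λ (v , p) → true ∷ v , p) , (λ (v , p) → false ∷ v , p) ]
  (λ { (true ∷ v , p) → inj₁ (v , p) ; (false ∷ v , p) → inj₂ (v , p) })
  (∃-Vec? n (P? ∘ (true ∷_)) ⊎-dec ∃-Vec? n (P? ∘ (false ∷_)))

∀-× : ∀ {A B} → Exhaustible A → Exhaustible B → Exhaustible (A × B)
∀-× ∀A? ∀B? P? = map′ (λ holds (a , b) → holds a b) (λ holds a b → holds (a , b))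
  (∀A? λ a → ∀B? λ b → P? (a , b))

∀-Pauli : Exhaustible Pauli
∀-Pauli P? = map′ (λ { (i , x , y , z) → λ { I → i ; X → x ; Y → y ; Z → z } })
  (λ holds → holds I , holds X , holds Y , holds Z) (P? I ×-dec P? X ×-dec P? Y ×-dec P? Z)

∀-P2 : Exhaustible P2
∀-P2 P? = map′ (λ holds (a ⊗ b) → holds (a , b)) (λ holds (a , b) → holds (a ⊗ b))
  (∀-× ∀-Pauli ∀-Pauli λ (a , b) → P? (a ⊗ b))

_≟₁_ : DecidableEquality Pauli
I ≟₁ I = yes refl
I ≟₁ X = no λ ()
I ≟₁ Y = no λ ()
I ≟₁ Z = no λ ()
X ≟₁ I = no λ ()
X ≟₁ X = yes refl
X ≟₁ Y = no λ ()
X ≟₁ Z = no λ ()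
Y ≟₁ I = no λ ()
Y ≟₁ X = no λ ()
Y ≟₁ Y = yes refl
Y ≟₁ Z = no λ ()
Z ≟₁ I = no λ ()
Z ≟₁ X = no λ ()
Z ≟₁ Y = no λ ()
Z ≟₁ Z = yes refl

_≟_ : DecidableEquality P2
(a ⊗ b) ≟ (c ⊗ d) = map′ (λ { (refl , refl) → refl }) (λ { refl → refl , refl }) (a ≟₁ c ×-dec b ≟₁ d)

_≟ₛ_ : ∀ {n} → DecidableEquality (Subset n)
_≟ₛ_ = Vec.≡-dec Bool._≟_

commute? : ∀ p q → Dec (Commute p q)
commute? (a ⊗ b) (c ⊗ d) = (anti₁ a c Bool.xor anti₁ b d) Bool.≟ false

isGeomHyperplane? : ∀ {n} (lines : List (List (Fin n))) → Decidable (IsGeomHyperplane lines)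
isGeomHyperplane? lines H = ¬? (H ≟ₛ ⊤) ×-dec
  all? (λ l → all? (_∈? H) l ⊎-dec length (filter (_∈? H) l) ℕ.≟ 1) lines

isVeldkampLine? : ∀ {n} (lines : List (List (Fin n))) H₁ H₂ H₃ → Dec (IsVeldkampLine lines H₁ H₂ H₃)
isVeldkampLine? lines H₁ H₂ H₃ =
  isGeomHyperplane? lines H₁ ×-dec isGeomHyperplane? lines H₂ ×-dec isGeomHyperplane? lines H₃ ×-dec
  ¬? (H₁ ≟ₛ H₂) ×-dec ¬? (H₁ ≟ₛ H₃) ×-dec ¬? (H₂ ≟ₛ H₃) ×-dec H₃ ≟ₛ ∁ (H₁ △ H₂)

isVLine? : ∀ H₁ H₂ H₃ → Dec (IsVLine H₁ H₂ H₃)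
isVLine? = isVeldkampLine? linesD6

commLine? : ∀ H₁ H₂ H₃ → Dec (CommLine H₁ H₂ H₃)
commLine? H₁ H₂ H₃ = isVLine? H₁ H₂ H₃ ×-dec
  commute? (hypLabelA H₁) (hypLabelA H₂) ×-dec commute? (hypLabelA H₁) (hypLabelA H₃) ×-dec
  commute? (hypLabelA H₂) (hypLabelA H₃)

hypThrough? : (S : Subset 7) → Decidable (λ H → IsHyp H × S ⊆ H)
hypThrough? S H = isGeomHyperplane? linesD6 H ×-dec S ⊆? H

nineLabel? : Decidable NineLabel
nineLabel? p = ¬? (p ≟ II) ×-dec ¬? (p ≟ IX) ×-dec ¬? (p ≟ IY) ×-dec ¬? (p ≟ IZ) ×-dec
  ¬? (p ≟ XI) ×-dec ¬? (p ≟ YI) ×-dec ¬? (p ≟ ZI)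

w32Line? : ∀ u v w → Dec (W32Line u v w)
w32Line? u v w = ¬? (u ≟ₛ zero4) ×-dec ¬? (v ≟ₛ zero4) ×-dec ¬? (w ≟ₛ zero4) ×-dec
  ¬? (u ≟ₛ v) ×-dec ¬? (u ≟ₛ w) ×-dec ¬? (v ≟ₛ w) ×-dec
  zipWith Bool._xor_ u v ≟ₛ w ×-dec ω u v Bool.≟ false

fanoLine? : ∀ u v w → Dec (FanoLine u v w)
fanoLine? u v w = ¬? (u ≟ₛ zero3) ×-dec ¬? (v ≟ₛ zero3) ×-dec ¬? (w ≟ₛ zero3) ×-dec
  ¬? (u ≟ₛ v) ×-dec ¬? (u ≟ₛ w) ×-dec ¬? (v ≟ₛ w) ×-dec zipWith Bool._xor_ u v ≟ₛ w

_≟²_ : DecidableEquality (Fin 3 × Fin 3)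
_≟²_ = ×.≡-dec Fin._≟_ Fin._≟_

gridLine? : ∀ x y z → Dec (GridLine x y z)
gridLine? x@(i₁ , j₁) y@(i₂ , j₂) z@(i₃ , j₃) = ¬? (x ≟² y) ×-dec ¬? (x ≟² z) ×-dec ¬? (y ≟² z) ×-dec
  ((i₁ Fin.≟ i₂ ×-dec i₂ Fin.≟ i₃) ⊎-dec (j₁ Fin.≟ j₂ ×-dec j₂ Fin.≟ j₃))

covered? : ∀ {m} {P : Subset 7 → Set} → Decidable P → (chart : Vec Bool m → Subset 7) →
  Dec (∀ H → P H → ∃[ k ] H ≡ chart k)
covered? {m} P? chart = ∀-Vec? 7 λ H → P? H →-dec ∃-Vec? m λ k → H ≟ₛ chart k

module Chart {m} {P : Subset 7 → Set} (P? : Decidable P) (chart : Vec Bool m → Subset 7)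
  (chart-onto : ∀ H → P H → ∃[ k ] H ≡ chart k) where

  private
    P?∘ : Decidable (P ∘ chart)
    P?∘ k = P? (chart k)

  every : ∀ {R : Subset 7 → Set} (R? : Decidable R)
    {_ : True (∀-Vec? m λ k → P?∘ k →-dec R? (chart k))} → ∀ H → P H → R H
  every R? {holds} H p with chart-onto H p
  ... | k , refl = toWitness holds k p

  every₂ : ∀ {R : Subset 7 → Subset 7 → Set} (R? : ∀ H H' → Dec (R H H'))
    {_ : True (∀-Vec? m λ k → P?∘ k →-dec ∀-Vec? m λ k' → P?∘ k' →-dec R? (chart k) (chart k'))} →
    ∀ H H' → P H → P H' → R H H'
  every₂ R? {holds} H H' p p' with chart-onto H p | chart-onto H' p'
  ... | k , refl | k' , refl = toWitness holds k p k' p'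

  every₃ : ∀ {R : Subset 7 → Subset 7 → Subset 7 → Set} (R? : ∀ H H' H'' → Dec (R H H' H''))
    {_ : True (∀-Vec? m λ k → P?∘ k →-dec ∀-Vec? m λ k' → P?∘ k' →-dec ∀-Vec? m λ k'' → P?∘ k'' →-dec
               R? (chart k) (chart k') (chart k''))} →
    ∀ H H' H'' → P H → P H' → P H'' → R H H' H''
  every₃ R? {holds} H H' H'' p p' p'' with chart-onto H p | chart-onto H' p' | chart-onto H'' p''
  ... | k , refl | k' , refl | k'' , refl = toWitness holds k p k' p' k'' p''

  exists? : ∀ {R : Subset 7 → Set} → Decidable R → Dec (∃[ H ] (P H × R H))
  exists? {R} R? = map′ (λ (k , p , r) → chart k , p , r) off-chart
    (∃-Vec? m λ k → P?∘ k ×-dec R? (chart k))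
    where
    off-chart : ∃[ H ] (P H × R H) → ∃[ k ] (P (chart k) × R (chart k))
    off-chart (H , p , r) with chart-onto H p
    ... | k , refl = k , p , r

  module Isomorphism {V : Set} (∀V? : Exhaustible V) (_≟V_ : DecidableEquality V)
    {Ln : Subset 7 → Subset 7 → Subset 7 → Set} (Ln? : ∀ H₁ H₂ H₃ → Dec (Ln H₁ H₂ H₃))
    {Q : V → Set} (Q? : Decidable Q) {M : V → V → V → Set} (M? : ∀ u v w → Dec (M u v w))
    (φ : Subset 7 → V) where

    Preserved : Subset 7 → Subset 7 → Subset 7 → Set
    Preserved H₁ H₂ H₃ = Ln H₁ H₂ H₃ ⇔ M (φ H₁) (φ H₂) (φ H₃)

    preserved? : ∀ H₁ H₂ H₃ → Dec (Preserved H₁ H₂ H₃)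
    preserved? H₁ H₂ H₃ =
      map′ (λ (to , from) → mk⇔ to from) (λ e → Equivalence.to e , Equivalence.from e)
        ((Ln? H₁ H₂ H₃ →-dec M? (φ H₁) (φ H₂) (φ H₃)) ×-dec (M? (φ H₁) (φ H₂) (φ H₃) →-dec Ln? H₁ H₂ H₃))

    maps? : Dec (∀ k → P (chart k) → Q (φ (chart k)))
    maps? = ∀-Vec? m λ k → P?∘ k →-dec Q? (φ (chart k))

    injective? : Dec (∀ k → P (chart k) → ∀ k' → P (chart k') → φ (chart k) ≡ φ (chart k') → chart k ≡ chart k')
    injective? = ∀-Vec? m λ k → P?∘ k →-dec ∀-Vec? m λ k' → P?∘ k' →-dec
      (φ (chart k) ≟V φ (chart k')) →-dec (chart k ≟ₛ chart k')

    surjective? : Dec (∀ v → Q v → ∃[ H ] (P H × φ H ≡ v))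
    surjective? = ∀V? λ v → Q? v →-dec exists? λ H → φ H ≟V v

    preserved-on-chart? : Dec (∀ k → P (chart k) → ∀ k' → P (chart k') → ∀ k'' → P (chart k'') →
                               Preserved (chart k) (chart k') (chart k''))
    preserved-on-chart? = ∀-Vec? m λ k → P?∘ k →-dec ∀-Vec? m λ k' → P?∘ k' →-dec ∀-Vec? m λ k'' → P?∘ k'' →-dec
      preserved? (chart k) (chart k') (chart k'')

    isomorphic :
      {_ : True maps?} {_ : True injective?} {_ : True surjective?} {_ : True preserved-on-chart?} →
      Isomorphic P Ln Q M
    isomorphic {m} {i} {s} {l} = record
      { φ = φ
      ; maps = every (λ H → Q? (φ H)) {m}
      ; injective = every₂ (λ H H' → (φ H ≟V φ H') →-dec (H ≟ₛ H')) {i}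
      ; surjective = toWitness s
      ; lines⇔ = every₃ {R = Preserved} preserved? {l}
      }

chart234 : Vec Bool 4 → Subset 7
chart234 (a ∷ b ∷ c ∷ d ∷ []) = a ∷ b ∷ true ∷ true ∷ true ∷ c ∷ d ∷ []

chart0134 : Vec Bool 3 → Subset 7
chart0134 (c ∷ f ∷ g ∷ []) = true ∷ true ∷ c ∷ true ∷ true ∷ f ∷ g ∷ []

chart2356 : Vec Bool 3 → Subset 7
chart2356 (a ∷ b ∷ e ∷ []) = a ∷ b ∷ true ∷ true ∷ e ∷ true ∷ true ∷ []

hyp234? : Decidable Hyp234
hyp234? = hypThrough? (setOf (p2 ∷ p3 ∷ p4 ∷ []))

hyp0134? : Decidable Hyp0134
hyp0134? = hypThrough? (setOf (p0 ∷ p1 ∷ p3 ∷ p4 ∷ []))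

hyp2356? : Decidable Hyp2356
hyp2356? = hypThrough? (setOf (p2 ∷ p3 ∷ p5 ∷ p6 ∷ []))

hyp9? : Decidable Hyp9
hyp9? H = hyp234? H ×-dec nineLabel? (hypLabelA H)

module Through234 = Chart hyp234? chart234 (from-yes (covered? hyp234? chart234))
module Through0134 = Chart hyp0134? chart0134 (from-yes (covered? hyp0134? chart0134))
module Through2356 = Chart hyp2356? chart2356 (from-yes (covered? hyp2356? chart2356))
module NineLabelled = Chart hyp9? chart234 (from-yes (covered? hyp9? chart234))

labels-agree : ∀ H → Hyp234 H → hypLabelA H ≡ hypLabelB H
labels-agree = Through234.every λ H → hypLabelA H ≟ hypLabelB H

label-nonidentity : ∀ H → Hyp234 H → hypLabelA H ≢ II
label-nonidentity = Through234.every λ H → ¬? (hypLabelA H ≟ II)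

label-injective : ∀ H H' → Hyp234 H → Hyp234 H' → hypLabelA H ≡ hypLabelA H' → H ≡ H'
label-injective = Through234.every₂ λ H H' → (hypLabelA H ≟ hypLabelA H') →-dec (H ≟ₛ H')

label-surjective : ∀ p → p ≢ II → ∃[ H ] (Hyp234 H × hypLabelA H ≡ p)
label-surjective = from-yes (∀-P2 λ p → ¬? (p ≟ II) →-dec Through234.exists? λ H → hypLabelA H ≟ p)

veldkamp-product : ∀ H₁ H₂ H₃ → Hyp234 H₁ → Hyp234 H₂ → Hyp234 H₃ → IsVLine H₁ H₂ H₃ →
  hypLabelA H₁ · hypLabelA H₂ · hypLabelA H₃ ≡ II
veldkamp-product = Through234.every₃ λ H₁ H₂ H₃ →
  isVLine? H₁ H₂ H₃ →-dec ((hypLabelA H₁ · hypLabelA H₂ · hypLabelA H₃) ≟ II)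

-- Symplectic coordinates (x₁, z₁, x₂, z₂): ω on them is the commutation form, and the
-- product of Pauli words is coordinatewise addition.
symplectic : P2 → V4
symplectic (a ⊗ b) = x a ∷ z a ∷ x b ∷ z b ∷ []
  where
  x z : Pauli → Bool
  x I = false
  x X = true
  x Y = true
  x Z = false
  z I = false
  z X = false
  z Y = true
  z Z = true

commuting-lines≅W32 : Isomorphic Hyp234 CommLine W32Point W32Line
commuting-lines≅W32 = Through234.Isomorphism.isomorphic (∀-Vec? 4) _≟ₛ_
  commLine? (λ u → ¬? (u ≟ₛ zero4)) w32Line? (symplectic ∘ hypLabelA)

-- Since H₃ = ∁ (H₁ △ H₂) means ∁ H₃ = ∁ H₁ △ ∁ H₂, complements add along Veldkamp lines;
-- on hyperplanes through a fixed set their free coordinates are Fano plane points.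
complementAt : ∀ {m} → Vec Pt m → Subset 7 → Vec Bool m
complementAt ps H = map (lookup (∁ H)) ps

hyp0134≅Fano : Isomorphic Hyp0134 IsVLine (λ u → u ≢ zero3) FanoLine
hyp0134≅Fano = Through0134.Isomorphism.isomorphic (∀-Vec? 3) _≟ₛ_
  isVLine? (λ u → ¬? (u ≟ₛ zero3)) fanoLine? (complementAt (p2 ∷ p5 ∷ p6 ∷ []))

hyp2356≅Fano : Isomorphic Hyp2356 IsVLine (λ u → u ≢ zero3) FanoLine
hyp2356≅Fano = Through2356.Isomorphism.isomorphic (∀-Vec? 3) _≟ₛ_
  isVLine? (λ u → ¬? (u ≟ₛ zero3)) fanoLine? (complementAt (p0 ∷ p1 ∷ p4 ∷ []))

-- The Mermin–Peres square
--   XX ZZ YY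
--   YZ XY ZX
--   ZY YX XZ
-- (labels outside it are sent anywhere).
magicSquareCell : P2 → Fin 3 × Fin 3
magicSquareCell (X ⊗ X) = zero , zero
magicSquareCell (Z ⊗ Z) = zero , suc zero
magicSquareCell (Y ⊗ Y) = zero , suc (suc zero)
magicSquareCell (Y ⊗ Z) = suc zero , zero
magicSquareCell (X ⊗ Y) = suc zero , suc zero
magicSquareCell (Z ⊗ X) = suc zero , suc (suc zero)
magicSquareCell (Z ⊗ Y) = suc (suc zero) , zero
magicSquareCell (Y ⊗ X) = suc (suc zero) , suc zero
magicSquareCell (X ⊗ Z) = suc (suc zero) , suc (suc zero)
magicSquareCell _ = zero , zero

nine-labels≅grid : Isomorphic Hyp9 CommLine GridPoint GridLine
nine-labels≅grid = NineLabelled.Isomorphism.isomorphic (∀-× ∀-Fin ∀-Fin) _≟²_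
  commLine? (λ _ → yes tt) gridLine? (magicSquareCell ∘ hypLabelA)

SharedLine : (Subset 7 → Set) → P2 → P2 → P2 → Set
SharedLine F a b c = ∃[ H₁ ] ∃[ H₂ ] ∃[ H₃ ] (IsVLine H₁ H₂ H₃
  × Hyp234 H₁ × Hyp234 H₂ × Hyp234 H₃ × F H₁ × F H₂ × F H₃
  × (∀ H → Hyp234 H → F H → H ≡ H₁ ⊎ H ≡ H₂ ⊎ H ≡ H₃)
  × hypLabelA H₁ ≡ a × hypLabelA H₂ ≡ b × hypLabelA H₃ ≡ c)

shared-line : ∀ {F} (F? : Decidable F) {a b c} H₁ H₂ H₃ →
  {_ : True (isVLine? H₁ H₂ H₃
             ×-dec hyp234? H₁ ×-dec hyp234? H₂ ×-dec hyp234? H₃ ×-dec F? H₁ ×-dec F? H₂ ×-dec F? H₃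
             ×-dec ∀-Vec? 7 (λ H → hyp234? H →-dec F? H →-dec (H ≟ₛ H₁ ⊎-dec H ≟ₛ H₂ ⊎-dec H ≟ₛ H₃))
             ×-dec hypLabelA H₁ ≟ a ×-dec hypLabelA H₂ ≟ b ×-dec hypLabelA H₃ ≟ c)} →
  SharedLine F a b c
shared-line F? H₁ H₂ H₃ {holds} = H₁ , H₂ , H₃ , toWitness holds

IX-IY-IZ-line : SharedLine Hyp0134 IX IY IZ
IX-IY-IZ-line = shared-line hyp0134?
  (chart234 (true ∷ true ∷ true ∷ false ∷ [])) (chart234 (true ∷ true ∷ false ∷ false ∷ []))
  (chart234 (true ∷ true ∷ false ∷ true ∷ []))

XI-YI-ZI-line : SharedLine Hyp2356 XI YI ZI
XI-YI-ZI-line = shared-line hyp2356?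
  (chart234 (true ∷ false ∷ true ∷ true ∷ [])) (chart234 (false ∷ false ∷ true ∷ true ∷ []))
  (chart234 (false ∷ true ∷ true ∷ true ∷ []))

LabelledII : Subset 7 → Subset 7 → Subset 7 → Set
LabelledII H₁ H₂ H₃ = IsVLine H₁ H₂ H₃ × hypLabelB H₁ ≡ II × hypLabelB H₂ ≡ II × hypLabelB H₃ ≡ II

identity-labelled-line :
  LabelledII (setOf (p0 ∷ p1 ∷ p3 ∷ p5 ∷ p6 ∷ [])) (setOf (p0 ∷ p1 ∷ p3 ∷ p4 ∷ p5 ∷ p6 ∷ []))
             (setOf (p0 ∷ p1 ∷ p2 ∷ p3 ∷ p5 ∷ p6 ∷ []))
identity-labelled-line = from-yes (isVLine? H₁ H₂ H₃) , refl , refl , refl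
  where
  H₁ H₂ H₃ : Subset 7
  H₁ = setOf (p0 ∷ p1 ∷ p3 ∷ p5 ∷ p6 ∷ [])
  H₂ = setOf (p0 ∷ p1 ∷ p3 ∷ p4 ∷ p5 ∷ p6 ∷ [])
  H₃ = setOf (p0 ∷ p1 ∷ p2 ∷ p3 ∷ p5 ∷ p6 ∷ [])

mainTheorem7 :
    (∀ H → Hyp234 H → hypLabelA H ≡ hypLabelB H)
    × (∀ H → Hyp234 H → hypLabelA H ≢ II)
    × (∀ H H' → Hyp234 H → Hyp234 H' → hypLabelA H ≡ hypLabelA H' → H ≡ H')
    × (∀ p → p ≢ II → ∃[ H ] (Hyp234 H × hypLabelA H ≡ p))
    × (∀ H₁ H₂ H₃ → Hyp234 H₁ → Hyp234 H₂ → Hyp234 H₃ → IsVLine H₁ H₂ H₃ →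
         hypLabelA H₁ · hypLabelA H₂ · hypLabelA H₃ ≡ II)
    × Isomorphic Hyp234 CommLine W32Point W32Line
    × Isomorphic Hyp0134 IsVLine (λ u → u ≢ zero3) FanoLine
    × Isomorphic Hyp2356 IsVLine (λ u → u ≢ zero3) FanoLine
    × (∃[ H₁ ] ∃[ H₂ ] ∃[ H₃ ] (IsVLine H₁ H₂ H₃
         × Hyp234 H₁ × Hyp234 H₂ × Hyp234 H₃ × Hyp0134 H₁ × Hyp0134 H₂ × Hyp0134 H₃
         × (∀ H → Hyp234 H → Hyp0134 H → H ≡ H₁ ⊎ H ≡ H₂ ⊎ H ≡ H₃)
         × hypLabelA H₁ ≡ IX × hypLabelA H₂ ≡ IY × hypLabelA H₃ ≡ IZ))
    × (∃[ H₁ ] ∃[ H₂ ] ∃[ H₃ ] (IsVLine H₁ H₂ H₃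
         × Hyp234 H₁ × Hyp234 H₂ × Hyp234 H₃ × Hyp2356 H₁ × Hyp2356 H₂ × Hyp2356 H₃
         × (∀ H → Hyp234 H → Hyp2356 H → H ≡ H₁ ⊎ H ≡ H₂ ⊎ H ≡ H₃)
         × hypLabelA H₁ ≡ XI × hypLabelA H₂ ≡ YI × hypLabelA H₃ ≡ ZI))
    × Isomorphic Hyp9 CommLine GridPoint GridLine
    × (IsVLine (setOf (p0 ∷ p1 ∷ p3 ∷ p5 ∷ p6 ∷ []))
               (setOf (p0 ∷ p1 ∷ p3 ∷ p4 ∷ p5 ∷ p6 ∷ []))
               (setOf (p0 ∷ p1 ∷ p2 ∷ p3 ∷ p5 ∷ p6 ∷ []))
       × hypLabelB (setOf (p0 ∷ p1 ∷ p3 ∷ p5 ∷ p6 ∷ [])) ≡ II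
       × hypLabelB (setOf (p0 ∷ p1 ∷ p3 ∷ p4 ∷ p5 ∷ p6 ∷ [])) ≡ II
       × hypLabelB (setOf (p0 ∷ p1 ∷ p2 ∷ p3 ∷ p5 ∷ p6 ∷ [])) ≡ II)
mainTheorem7 =
  labels-agree , label-nonidentity , label-injective , label-surjective , veldkamp-product ,
  commuting-lines≅W32 , hyp0134≅Fano , hyp2356≅Fano , IX-IY-IZ-line , XI-YI-ZI-line ,
  nine-labels≅grid , identity-labelled-line
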